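{- For every integer $m\geq 3$, $\lambda_1^1(P_m \times C_3)=5$.
   Context: For a graph $G$, an $L(1,1)$-labeling with labels in $\{0,1,\dots,p\}$ is a function $l:V(G)\to\{0,1,\dots,p\}$ such that $l(u)\neq l(v)$ whenever the distance $d(u,v)$ is $1$ or $2$. $\lambda_1^1(G)$ denotes the least $p$ for which $G$ admits such a labeling. $P_m$ denotes the path with $m$ vertices and $C_n$ the cycle with $n$ vertices. The direct product $G\times H$ has vertex set $V(G)\times V(H)$, with $(x_1,x_2)$ adjacent to $(y_1,y_2)$ iff $x_1y_1\in E(G)$ and $x_2y_2\in E(H)$. -}

module Defs where

open import Data.Nat using (ℕ; zero; suc; _≤_; _%_; NonZero)
open import Data.Fin using (Fin; toℕ)
open import Data.Product using (_×_; _,_; ∃-syntax)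
open import Data.Sum using (_⊎_)
open import Relation.Binary.PropositionalEquality using (_≡_; _≢_)
open import Relation.Nullary using (¬_)

record Graph : Set₁ where
  field
    V   : Set
    Adj : V → V → Set
open Graph public

P : ℕ → Graph
P m = record { V = Fin m ; Adj = λ i j → (suc (toℕ i) ≡ toℕ j) ⊎ (suc (toℕ j) ≡ toℕ i) }

C : (n : ℕ) → .{{NonZero n}} → Graph
C n = record { V = Fin n ; Adj = λ i j → ((suc (toℕ i)) % n ≡ toℕ j) ⊎ ((suc (toℕ j)) % n ≡ toℕ i) }

_×ᵈ_ : Graph → Graph → Graph
G ×ᵈ H = record { V = V G × V H
                ; Adj = λ { (x₁ , x₂) (y₁ , y₂) → Adj G x₁ y₁ × Adj H x₂ y₂ } }

Dist12 : (G : Graph) → V G → V G → Set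
Dist12 G u v = u ≢ v × (Adj G u v ⊎ ∃[ w ] (Adj G u w × Adj G w v))

IsL11Labeling : (G : Graph) (p : ℕ) → (V G → Fin (suc p)) → Set
IsL11Labeling G p l = ∀ u v → Dist12 G u v → l u ≢ l v

HasL11Labeling : Graph → ℕ → Set
HasL11Labeling G p = ∃[ l ] IsL11Labeling G p l

λ11≡ : Graph → ℕ → Set
λ11≡ G p = HasL11Labeling G p × (∀ q → HasL11Labeling G q → p ≤ q)

-- Upper bound: label (i , a) by the pair (⌊i/2⌋ mod 2 , a) ∈ Fin 2 × Fin 3. Two vertices at
-- distance ≤ 2 with the same C₃-coordinate cannot be adjacent (C₃ has no loops), so they have a
-- common neighbour and their path coordinates are two apart, where ⌊i/2⌋ mod 2 changes.
-- Lower bound: any two of the six vertices in rows 0 and 2 have a common neighbour in row 1,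
-- because any two vertices of C₃ (equal or not) have a common neighbour; so six labels are needed.
module Submission where

open import Defs
open import Data.Nat using (ℕ; suc; _+_; _≥_; _≤_; s≤s; s≤s⁻¹)
open import Data.Nat.Properties using (suc-injective; ≰⇒>; _≤?_)
open import Data.Fin using (Fin; toℕ; combine; remQuot; opposite)
open import Data.Fin.Patterns using (0F; 1F; 2F)
open import Data.Fin.Properties using (toℕ-injective; pigeonhole; <⇒≢; combine-injective; combine-remQuot)
open import Data.Product using (_×_; _,_; ∃-syntax; uncurry; map₁)
open import Data.Product.Properties using (,-injectiveˡ; ,-injectiveʳ)
open import Data.Sum using (_⊎_; inj₁; inj₂)
open import Function using (_∘_)
open import Function.Definitions using (Injective)
open import Relation.Nullary using (¬_; yes; no; contradiction)
open import Relation.Binary.PropositionalEquality using (_≡_; _≢_; refl; sym; trans; cong; cong₂)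

CommonNeighbour : (G : Graph) → V G → V G → Set
CommonNeighbour G u v = ∃[ w ] (Adj G u w × Adj G w v)

SquareClique : (G : Graph) {A : Set} → (A → V G) → Set
SquareClique G f = ∀ i j → i ≢ j → Dist12 G (f i) (f j)

SeparatesCommonNeighbours : (G : Graph) {A : Set} → (V G → A) → Set
SeparatesCommonNeighbours G g = ∀ x y → x ≢ y → CommonNeighbour G x y → g x ≢ g y

squareClique-size≤labels : (G : Graph) {k q : ℕ} (f : Fin k → V G) →
                           SquareClique G f → HasL11Labeling G q → k ≤ suc q
squareClique-size≤labels G {k} {q} f clique (l , l-ok) with k ≤? suc q
... | yes k≤1+q = k≤1+q
... | no  k≰1+q with i , j , i<j , li≡lj ← pigeonhole (≰⇒> k≰1+q) (l ∘ f) =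
  contradiction li≡lj (l-ok (f i) (f j) (clique i j (<⇒≢ i<j)))

squareClique-∘-injective : (G : Graph) {A B : Set} {f : A → V G} {h : B → A} →
                           SquareClique G f → Injective _≡_ _≡_ h → SquareClique G (f ∘ h)
squareClique-∘-injective G clique h-injective i j i≢j = clique _ _ (i≢j ∘ h-injective)

×ᵈ-commonNeighbour : (G H : Graph) {x y : V G} {a b : V H} →
                     CommonNeighbour G x y → CommonNeighbour H a b →
                     CommonNeighbour (G ×ᵈ H) (x , a) (y , b)
×ᵈ-commonNeighbour G H (w , xw , wy) (c , ac , cb) = (w , c) , (xw , ac) , (wy , cb)

×ᵈ-L11Labeling : (G H : Graph) {A : Set} {p : ℕ} (g : V G → A) (ℓ : A × V H → Fin (suc p)) →
                 Injective _≡_ _≡_ ℓ → (∀ a → ¬ Adj H a a) → SeparatesCommonNeighbours G g →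
                 IsL11Labeling (G ×ᵈ H) p (λ (x , a) → ℓ (g x , a))
×ᵈ-L11Labeling G H g ℓ ℓ-injective H-loopless g-separates (x , a) (y , b) (xa≢yb , near) ℓ≡
  with refl ← ,-injectiveʳ (ℓ-injective ℓ≡) | near
... | inj₁ (_ , aa) = H-loopless a aa
... | inj₂ ((w , _) , (xw , _) , (wy , _)) =
  g-separates x y (λ { refl → xa≢yb refl }) (w , xw , wy) (,-injectiveˡ (ℓ-injective ℓ≡))

P-commonNeighbour⇒twoApart : ∀ {m} {x y : Fin m} → x ≢ y → CommonNeighbour (P m) x y →
                             toℕ y ≡ 2 + toℕ x ⊎ toℕ x ≡ 2 + toℕ y
P-commonNeighbour⇒twoApart x≢y (w , inj₁ x+1≡w , inj₁ w+1≡y) = inj₁ (sym (trans (cong suc x+1≡w) w+1≡y))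
P-commonNeighbour⇒twoApart x≢y (w , inj₁ x+1≡w , inj₂ y+1≡w) =
  contradiction (toℕ-injective (suc-injective (trans x+1≡w (sym y+1≡w)))) x≢y
P-commonNeighbour⇒twoApart x≢y (w , inj₂ w+1≡x , inj₁ w+1≡y) =
  contradiction (toℕ-injective (trans (sym w+1≡x) w+1≡y)) x≢y
P-commonNeighbour⇒twoApart x≢y (w , inj₂ w+1≡x , inj₂ y+1≡w) = inj₂ (sym (trans (cong suc y+1≡w) w+1≡x))

blockParity : ℕ → Fin 2
blockParity 0             = 0F
blockParity 1             = 0F
blockParity (suc (suc n)) = opposite (blockParity n)

blockParity-twoApart : ∀ n → blockParity n ≢ blockParity (2 + n)
blockParity-twoApart n with blockParity n
... | 0F = λ ()
... | 1F = λ ()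

blockParity-separates : ∀ m → SeparatesCommonNeighbours (P m) (blockParity ∘ toℕ)
blockParity-separates m x y x≢y xy-near eq with P-commonNeighbour⇒twoApart x≢y xy-near
... | inj₁ y≡2+x = blockParity-twoApart (toℕ x) (trans eq (cong blockParity y≡2+x))
... | inj₂ x≡2+y = blockParity-twoApart (toℕ y) (trans (sym eq) (cong blockParity x≡2+y))

C₃-loopless : ∀ a → ¬ Adj (C 3) a a
C₃-loopless 0F (inj₁ ())
C₃-loopless 0F (inj₂ ())
C₃-loopless 1F (inj₁ ())
C₃-loopless 1F (inj₂ ())
C₃-loopless 2F (inj₁ ())
C₃-loopless 2F (inj₂ ())

C₃-commonNeighbour : ∀ a b → CommonNeighbour (C 3) a b
C₃-commonNeighbour 0F 0F = 1F , inj₁ refl , inj₂ refl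
C₃-commonNeighbour 0F 1F = 2F , inj₂ refl , inj₂ refl
C₃-commonNeighbour 0F 2F = 1F , inj₁ refl , inj₁ refl
C₃-commonNeighbour 1F 0F = 2F , inj₁ refl , inj₁ refl
C₃-commonNeighbour 1F 1F = 0F , inj₂ refl , inj₁ refl
C₃-commonNeighbour 1F 2F = 0F , inj₂ refl , inj₂ refl
C₃-commonNeighbour 2F 0F = 1F , inj₂ refl , inj₂ refl
C₃-commonNeighbour 2F 1F = 0F , inj₁ refl , inj₁ refl
C₃-commonNeighbour 2F 2F = 0F , inj₁ refl , inj₂ refl

combine-injective′ : ∀ {m n} → Injective _≡_ _≡_ (uncurry (combine {m} {n}))
combine-injective′ {x = i , j} {y = k , l} eq = uncurry (cong₂ _,_) (combine-injective i j k l eq)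

remQuot-injective : ∀ {m} n → Injective _≡_ _≡_ (remQuot {m} n)
remQuot-injective {m} n {i} {j} eq =
  trans (sym (combine-remQuot {m} n i)) (trans (cong (uncurry combine) eq) (combine-remQuot {m} n j))

evenRow : ∀ {n} → Fin 2 → Fin (3 + n)
evenRow 0F = 0F
evenRow 1F = 2F

evenRow-injective : ∀ {n} → Injective _≡_ _≡_ (evenRow {n})
evenRow-injective {x = 0F} {0F} _ = refl
evenRow-injective {x = 0F} {1F} ()
evenRow-injective {x = 1F} {0F} ()
evenRow-injective {x = 1F} {1F} _ = refl

evenRow-commonNeighbour : ∀ {n} r s → CommonNeighbour (P (3 + n)) (evenRow r) (evenRow s)
evenRow-commonNeighbour r s = 1F , evenRow-1F r , 1F-evenRow s
  where
  evenRow-1F : ∀ r → Adj (P (3 + _)) (evenRow r) 1F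
  evenRow-1F 0F = inj₁ refl
  evenRow-1F 1F = inj₂ refl
  1F-evenRow : ∀ s → Adj (P (3 + _)) 1F (evenRow s)
  1F-evenRow 0F = inj₂ refl
  1F-evenRow 1F = inj₁ refl

evenRows×C₃ : ∀ n → Fin 2 × Fin 3 → V (P (3 + n) ×ᵈ C 3)
evenRows×C₃ n = map₁ evenRow

evenRows×C₃-squareClique : ∀ n → SquareClique (P (3 + n) ×ᵈ C 3) (evenRows×C₃ n)
evenRows×C₃-squareClique n (r , a) (s , b) ra≢sb =
  (λ eq → ra≢sb (cong₂ _,_ (evenRow-injective (,-injectiveˡ eq)) (,-injectiveʳ eq)))
  , inj₂ (×ᵈ-commonNeighbour (P _) (C 3) (evenRow-commonNeighbour r s) (C₃-commonNeighbour a b))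

mainTheorem8 : (m : ℕ) → m ≥ 3 → λ11≡ (P m ×ᵈ C 3) 5
mainTheorem8 m@(suc (suc (suc n))) (s≤s (s≤s (s≤s _))) = (_ , labeling) , λ _ → s≤s⁻¹ ∘ sixLabels
  where
  G : Graph
  G = P m ×ᵈ C 3
  labeling : IsL11Labeling G 5 (λ (i , a) → combine (blockParity (toℕ i)) a)
  labeling = ×ᵈ-L11Labeling (P m) (C 3) (blockParity ∘ toℕ) (uncurry combine)
                            combine-injective′ C₃-loopless (blockParity-separates m)
  sixLabels : ∀ {q} → HasL11Labeling G q → 6 ≤ suc q
  sixLabels = squareClique-size≤labels G (evenRows×C₃ n ∘ remQuot 3)
                (squareClique-∘-injective G (evenRows×C₃-squareClique n) (remQuot-injective 3))
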